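{- Assume $q=|\mathcal{A}|\ge2$. Then $T(V)$ and $T(X)$ are closed under the concatenation product $z\,\Vert\, z'=z\otimes z'$, while $T(W)$ is not closed under concatenation.
   Context: $\mathcal{A}$ is a finite alphabet with $q$ letters, $V_\mathcal{A}=\mathbb{C}^q$ with standard basis $\{e_a\}$, $V_\mathcal{A}^m$ its $m$-fold tensor power, $V_\mathcal{A}^0=\mathbb{C}$. $f_0=q^{ -1/2}\sum_a e_a$. For $m\ge1$, $\theta_L,\theta_R:V_\mathcal{A}^m\to V_\mathcal{A}^{m-1}$ are linear with $\theta_L(v_1\otimes\cdots\otimes v_m)=\langle f_0,v_1\rangle v_2\otimes\cdots\otimes v_m$, $\theta_R(v_1\otimes\cdots\otimes v_m)=\langle f_0,v_m\rangle v_1\otimes\cdots\otimes v_{m-1}$, and both are $0$ on $V_\mathcal{A}^0$. Set $W_\mathcal{A}^k=\ker(\theta_L-\theta_R)$, $X_\mathcal{A}^k=\ker\theta_L\cap\ker\theta_R$ (subspaces of $V_\mathcal{A}^k$), $T(V)=\bigoplus_{k\ge0}V_\mathcal{A}^k$, $T(W)=\bigoplus_k W_\mathcal{A}^k$, $T(X)=\bigoplus_k X_\mathcal{A}^k$. Concatenation of $z\in V_\mathcal{A}^k$ and $z'\in V_\mathcal{A}^l$ is $z\otimes z'\in V_\mathcal{A}^{k+l}$, extended bilinearly. -}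

module Defs where

open import Level using (_⊔_)
open import Algebra.Bundles using (CommutativeRing)
open import Data.Nat using (ℕ; zero; suc; _≤_)
open import Data.Fin using (Fin)
import Data.Fin as Fin
open import Data.List using (List; []; _∷_; _++_; [_]; map; length)
open import Data.Product using (_×_; _,_; ∃)
open import Relation.Nullary using (¬_)

IsField : ∀ {c ℓ} → CommutativeRing c ℓ → Set (c ⊔ ℓ)
IsField R = ¬ (1# ≈ 0#) × (∀ x → ¬ (x ≈ 0#) → ∃ λ y → x * y ≈ 1#)
  where open CommutativeRing R

natToRing : ∀ {c ℓ} (R : CommutativeRing c ℓ) → ℕ → CommutativeRing.Carrier R
natToRing R zero = CommutativeRing.0# R
natToRing R (suc n) = CommutativeRing._+_ R (CommutativeRing.1# R) (natToRing R n)

-- A basis of V_A^m is {e_w : w word of length m}; an element of T(V) is a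
-- coefficient function on all words (of all lengths) with finite support
-- (finitely many nonzero homogeneous components, each finite dimensional).
-- The parameter t plays the role of q^{-1/2}, so f_0 = t · Σ_a e_a and
-- ⟨f_0 , e_a⟩ = t.
module Tensor {c ℓ} (R : CommutativeRing c ℓ) (q : ℕ)
              (t : CommutativeRing.Carrier R) where
  open CommutativeRing R

  Word : Set
  Word = List (Fin q)

  Elem : Set c
  Elem = Word → Carrier

  sumFin : ∀ {n} → (Fin n → Carrier) → Carrier
  sumFin {zero} f = 0#
  sumFin {suc n} f = f Fin.zero + sumFin (λ i → f (Fin.suc i))

  sumList : List Carrier → Carrier
  sumList [] = 0#
  sumList (x ∷ xs) = x + sumList xs

  θL : Elem → Elem
  θL z w = sumFin (λ a → t * z (a ∷ w))

  θR : Elem → Elem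
  θR z w = sumFin (λ a → t * z (w ++ [ a ]))

  splits : Word → List (Word × Word)
  splits [] = ([] , []) ∷ []
  splits (x ∷ xs) = ([] , x ∷ xs) ∷ map (λ p → (x ∷ Data.Product.proj₁ p , Data.Product.proj₂ p)) (splits xs)

  -- concatenation product z ‖ z' (bilinear extension of e_u ⊗ e_v = e_{uv})
  _‖_ : Elem → Elem → Elem
  (z ‖ z') w = sumList (map (λ p → z (Data.Product.proj₁ p) * z' (Data.Product.proj₂ p)) (splits w))

  InTV : Elem → Set ℓ
  InTV z = ∃ λ (N : ℕ) → ∀ (w : Word) → N ≤ length w → z w ≈ 0#

  -- membership in T(X): every homogeneous component of degree ≥ 1 lies in
  -- ker θ_L ∩ ker θ_R (degree 0 is unconstrained since θ = 0 on V^0)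
  InTX : Elem → Set ℓ
  InTX z = InTV z × (∀ (w : Word) → (θL z w ≈ 0#) × (θR z w ≈ 0#))

  InTW : Elem → Set ℓ
  InTW z = InTV z × (∀ (w : Word) → θL z w ≈ θR z w)

{-# OPTIONS --safe #-}
-- Concatenation adds degree bounds, so finitely supported elements are closed
-- under it. The contractions obey Leibniz rules
--   θL (z ‖ z') = z∅ · θL z' + θL z ‖ z'   and   θR (z ‖ z') = z ‖ θR z' + θR z · z'∅,
-- with z∅ the degree-0 coefficient of z, so both vanish on z ‖ z' when they
-- vanish on z and z'; this gives T(X). Every degree-one vector lies in W, yet for
-- distinct letters a and b we have θL (e_a ⊗ e_b) = t e_b and θR (e_a ⊗ e_b) = t e_a,
-- which differ because t is invertible; so T(W) is not closed.
module Submission where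

open import Defs
open import Algebra.Bundles using (CommutativeRing)
open import Data.Nat as ℕ using (ℕ; zero; suc; _≤_; z≤n; s≤s; _≤?_)
open import Data.Nat.Properties using (≰⇒>; +-mono-<; <⇒≱)
open import Data.Fin using (Fin; zero; suc)
open import Data.List using (List; []; _∷_; _++_; [_]; map; length)
open import Data.List.Properties using (map-∘; map-++; length-++)
open import Data.List.Relation.Unary.All as All using (All; []; _∷_)
open import Data.List.Relation.Unary.All.Properties using (map⁺)
open import Data.Product using (_×_; _,_; proj₁; proj₂)
open import Function using (_∘_)
open import Data.Sum using (_⊎_; inj₁; inj₂)
open import Relation.Nullary using (¬_; yes; no; contradiction)
import Relation.Binary.PropositionalEquality as ≡
open ≡ using (_≡_)

≤-+-split : ∀ m n {a b} → m ℕ.+ n ≤ a ℕ.+ b → m ≤ a ⊎ n ≤ b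
≤-+-split m n {a} {b} m+n≤a+b with m ≤? a | n ≤? b
... | yes m≤a | _       = inj₁ m≤a
... | no _    | yes n≤b = inj₂ n≤b
... | no m≰a  | no n≰b  = contradiction m+n≤a+b (<⇒≱ (+-mono-< (≰⇒> m≰a) (≰⇒> n≰b)))

module TensorAlgebra {c ℓ} (R : CommutativeRing c ℓ) (q : ℕ) (t : CommutativeRing.Carrier R) where
  open CommutativeRing R hiding (zero)
  open Tensor R q t
  open import Algebra.Properties.Semiring.Sum semiring
    using (sum; sum-cong-≋; sum-replicate-zero; ∑-distrib-+; *-distribˡ-sum; *-distribʳ-sum)
  open import Algebra.Properties.CommutativeSemigroup *-commutativeSemigroup using (x∙yz≈y∙xz)

  splits-++ : ∀ w → All (λ p → proj₁ p ++ proj₂ p ≡ w) (splits w)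
  splits-++ []      = ≡.refl ∷ []
  splits-++ (x ∷ w) = ≡.refl ∷ map⁺ (All.map (≡.cong (x ∷_)) (splits-++ w))

  splits-∷ʳ : ∀ w a → splits (w ++ [ a ]) ≡
              map (λ p → (proj₁ p , proj₂ p ++ [ a ])) (splits w) ++ [ (w ++ [ a ] , []) ]
  splits-∷ʳ []      a = ≡.refl
  splits-∷ʳ (x ∷ w) a = ≡.cong (([] , x ∷ w ++ [ a ]) ∷_) (begin
      map consˣ (splits (w ++ [ a ]))
    ≡⟨ ≡.cong (map consˣ) (splits-∷ʳ w a) ⟩
      map consˣ (map snocᵃ (splits w) ++ [ (w ++ [ a ] , []) ])
    ≡⟨ map-++ consˣ (map snocᵃ (splits w)) _ ⟩
      map consˣ (map snocᵃ (splits w)) ++ [ (x ∷ w ++ [ a ] , []) ]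
    ≡⟨ ≡.cong (_++ [ (x ∷ w ++ [ a ] , []) ]) (≡.sym (map-∘ (splits w))) ⟩
      map (snocᵃ ∘ consˣ) (splits w) ++ [ (x ∷ w ++ [ a ] , []) ]
    ≡⟨ ≡.cong (_++ [ (x ∷ w ++ [ a ] , []) ]) (map-∘ (splits w)) ⟩
      map snocᵃ (map consˣ (splits w)) ++ [ (x ∷ w ++ [ a ] , []) ] ∎)
    where
    open ≡.≡-Reasoning
    consˣ snocᵃ : Word × Word → Word × Word
    consˣ p = (x ∷ proj₁ p , proj₂ p)
    snocᵃ p = (proj₁ p , proj₂ p ++ [ a ])

  open import Relation.Binary.Reasoning.Setoid setoid

  sumFin≡sum : ∀ {n} (f : Fin n → Carrier) → sumFin f ≡ sum f
  sumFin≡sum {zero}  f = ≡.refl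
  sumFin≡sum {suc n} f = ≡.cong (f zero +_) (sumFin≡sum (λ i → f (suc i)))

  sumFin-cong : ∀ {n} {f g : Fin n → Carrier} → (∀ a → f a ≈ g a) → sumFin f ≈ sumFin g
  sumFin-cong {f = f} {g} f≈g rewrite sumFin≡sum f | sumFin≡sum g = sum-cong-≋ f≈g

  sumFin-zero : ∀ {n} {f : Fin n → Carrier} → (∀ a → f a ≈ 0#) → sumFin f ≈ 0#
  sumFin-zero {n} {f} f≈0 rewrite sumFin≡sum f = trans (sum-cong-≋ f≈0) (sum-replicate-zero n)

  sumFin-+ : ∀ {n} (f g : Fin n → Carrier) → sumFin (λ a → f a + g a) ≈ sumFin f + sumFin g
  sumFin-+ f g rewrite sumFin≡sum (λ a → f a + g a) | sumFin≡sum f | sumFin≡sum g = ∑-distrib-+ f g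

  *-distribˡ-sumFin : ∀ {n} x (f : Fin n → Carrier) → x * sumFin f ≈ sumFin (λ a → x * f a)
  *-distribˡ-sumFin x f rewrite sumFin≡sum f | sumFin≡sum (λ a → x * f a) = *-distribˡ-sum x f

  *-distribʳ-sumFin : ∀ {n} x (f : Fin n → Carrier) → sumFin f * x ≈ sumFin (λ a → f a * x)
  *-distribʳ-sumFin x f rewrite sumFin≡sum f | sumFin≡sum (λ a → f a * x) = *-distribʳ-sum x f

  sumOver : ∀ {A : Set} → (A → Carrier) → List A → Carrier
  sumOver f xs = sumList (map f xs)

  sumOver-cong : ∀ {A : Set} {f g : A → Carrier} (xs : List A) →
                 (∀ x → f x ≈ g x) → sumOver f xs ≈ sumOver g xs
  sumOver-cong []       f≈g = refl
  sumOver-cong (x ∷ xs) f≈g = +-cong (f≈g x) (sumOver-cong xs f≈g)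

  sumOver-zero : ∀ {A : Set} {f : A → Carrier} {xs : List A} →
                 All (λ x → f x ≈ 0#) xs → sumOver f xs ≈ 0#
  sumOver-zero []           = refl
  sumOver-zero (fx≈0 ∷ f≈0) = trans (+-cong fx≈0 (sumOver-zero f≈0)) (+-identityʳ 0#)

  sumOver-++ : ∀ {A : Set} (f : A → Carrier) (xs ys : List A) →
               sumOver f (xs ++ ys) ≈ sumOver f xs + sumOver f ys
  sumOver-++ f []       ys = sym (+-identityˡ _)
  sumOver-++ f (x ∷ xs) ys = trans (+-congˡ (sumOver-++ f xs ys)) (sym (+-assoc _ _ _))

  sumOver-map : ∀ {A B : Set} (f : B → Carrier) (g : A → B) (xs : List A) →
                sumOver f (map g xs) ≡ sumOver (λ x → f (g x)) xs
  sumOver-map f g xs = ≡.cong sumList (≡.sym (map-∘ xs))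

  *-distribˡ-sumOver : ∀ {A : Set} x (f : A → Carrier) (xs : List A) →
                       x * sumOver f xs ≈ sumOver (λ y → x * f y) xs
  *-distribˡ-sumOver x f []       = zeroʳ x
  *-distribˡ-sumOver x f (y ∷ xs) = trans (distribˡ x _ _) (+-congˡ (*-distribˡ-sumOver x f xs))

  sumFin-sumOver-comm : ∀ {n} {A : Set} (f : Fin n → A → Carrier) (xs : List A) →
                        sumFin (λ a → sumOver (f a) xs) ≈ sumOver (λ x → sumFin (λ a → f a x)) xs
  sumFin-sumOver-comm {n} f []       = sumFin-zero {n} (λ _ → refl)
  sumFin-sumOver-comm     f (x ∷ xs) =
    trans (sumFin-+ (λ a → f a x) (λ a → sumOver (f a) xs)) (+-congˡ (sumFin-sumOver-comm f xs))

  ‖-∷ : ∀ z z' a w → (z ‖ z') (a ∷ w) ≡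
        z [] * z' (a ∷ w) + sumOver (λ p → z (a ∷ proj₁ p) * z' (proj₂ p)) (splits w)
  ‖-∷ z z' a w = ≡.cong (z [] * z' (a ∷ w) +_) (sumOver-map _ _ (splits w))

  ‖-∷ʳ : ∀ z z' w a → (z ‖ z') (w ++ [ a ]) ≈
         sumOver (λ p → z (proj₁ p) * z' (proj₂ p ++ [ a ])) (splits w) + z (w ++ [ a ]) * z' []
  ‖-∷ʳ z z' w a = begin
      sumOver term (splits (w ++ [ a ]))
    ≡⟨ ≡.cong (sumOver term) (splits-∷ʳ w a) ⟩
      sumOver term (map snocᵃ (splits w) ++ [ (w ++ [ a ] , []) ])
    ≈⟨ sumOver-++ term (map snocᵃ (splits w)) _ ⟩
      sumOver term (map snocᵃ (splits w)) + (z (w ++ [ a ]) * z' [] + 0#)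
    ≈⟨ +-cong (reflexive (sumOver-map term snocᵃ (splits w))) (+-identityʳ _) ⟩
      sumOver (λ p → z (proj₁ p) * z' (proj₂ p ++ [ a ])) (splits w) + z (w ++ [ a ]) * z' [] ∎
    where
    term : Word × Word → Carrier
    term p = z (proj₁ p) * z' (proj₂ p)
    snocᵃ : Word × Word → Word × Word
    snocᵃ p = (proj₁ p , proj₂ p ++ [ a ])

  θL-‖ : ∀ z z' w → θL (z ‖ z') w ≈ z [] * θL z' w + (θL z ‖ z') w
  θL-‖ z z' w = begin
      sumFin (λ a → t * (z ‖ z') (a ∷ w))
    ≈⟨ sumFin-cong {q} (λ a → trans (*-congˡ (reflexive (‖-∷ z z' a w))) (distribˡ t _ _)) ⟩
      sumFin (λ a → t * (z [] * z' (a ∷ w)) + t * sumOver (tail a) (splits w))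
    ≈⟨ sumFin-+ {q} _ _ ⟩
      sumFin (λ a → t * (z [] * z' (a ∷ w))) + sumFin (λ a → t * sumOver (tail a) (splits w))
    ≈⟨ +-cong (sumFin-cong {q} (λ a → x∙yz≈y∙xz t (z []) _))
              (sumFin-cong {q} (λ a → *-distribˡ-sumOver t (tail a) (splits w))) ⟩
      sumFin (λ a → z [] * (t * z' (a ∷ w))) + sumFin (λ a → sumOver (λ p → t * tail a p) (splits w))
    ≈⟨ +-cong (sym (*-distribˡ-sumFin {q} (z []) _)) (sumFin-sumOver-comm {q} _ (splits w)) ⟩
      z [] * θL z' w + sumOver (λ p → sumFin (λ a → t * tail a p)) (splits w)
    ≈⟨ +-congˡ (sumOver-cong (splits w) (λ p →
         trans (sumFin-cong {q} (λ a → sym (*-assoc t _ _))) (sym (*-distribʳ-sumFin {q} (z' (proj₂ p)) _)))) ⟩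
      z [] * θL z' w + (θL z ‖ z') w ∎
    where
    tail : Fin q → Word × Word → Carrier
    tail a p = z (a ∷ proj₁ p) * z' (proj₂ p)

  θR-‖ : ∀ z z' w → θR (z ‖ z') w ≈ (z ‖ θR z') w + θR z w * z' []
  θR-‖ z z' w = begin
      sumFin (λ a → t * (z ‖ z') (w ++ [ a ]))
    ≈⟨ sumFin-cong {q} (λ a → trans (*-congˡ (‖-∷ʳ z z' w a)) (distribˡ t _ _)) ⟩
      sumFin (λ a → t * sumOver (init a) (splits w) + t * (z (w ++ [ a ]) * z' []))
    ≈⟨ sumFin-+ {q} _ _ ⟩
      sumFin (λ a → t * sumOver (init a) (splits w)) + sumFin (λ a → t * (z (w ++ [ a ]) * z' []))
    ≈⟨ +-cong (sumFin-cong {q} (λ a → *-distribˡ-sumOver t (init a) (splits w)))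
              (sumFin-cong {q} (λ a → sym (*-assoc t _ _))) ⟩
      sumFin (λ a → sumOver (λ p → t * init a p) (splits w)) + sumFin (λ a → t * z (w ++ [ a ]) * z' [])
    ≈⟨ +-cong (sumFin-sumOver-comm {q} _ (splits w)) (sym (*-distribʳ-sumFin {q} (z' []) _)) ⟩
      sumOver (λ p → sumFin (λ a → t * init a p)) (splits w) + θR z w * z' []
    ≈⟨ +-congʳ (sumOver-cong (splits w) (λ p →
         trans (sumFin-cong {q} (λ a → x∙yz≈y∙xz t (z (proj₁ p)) _)) (sym (*-distribˡ-sumFin {q} (z (proj₁ p)) _)))) ⟩
      (z ‖ θR z') w + θR z w * z' [] ∎
    where
    init : Fin q → Word × Word → Carrier
    init a p = z (proj₁ p) * z' (proj₂ p ++ [ a ])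

  Vanishes : Elem → Set ℓ
  Vanishes z = ∀ w → z w ≈ 0#

  VanishesFrom : ℕ → Elem → Set ℓ
  VanishesFrom n z = ∀ w → n ≤ length w → z w ≈ 0#

  ‖-zeroˡ : ∀ {z} z' → Vanishes z → Vanishes (z ‖ z')
  ‖-zeroˡ z' z≈0 w = sumOver-zero (All.universal (λ p → trans (*-congʳ (z≈0 (proj₁ p))) (zeroˡ _)) (splits w))

  ‖-zeroʳ : ∀ z {z'} → Vanishes z' → Vanishes (z ‖ z')
  ‖-zeroʳ z z'≈0 w = sumOver-zero (All.universal (λ p → trans (*-congˡ (z'≈0 (proj₂ p))) (zeroʳ _)) (splits w))

  ‖-vanishesFrom : ∀ {m n z z'} → VanishesFrom m z → VanishesFrom n z' → VanishesFrom (m ℕ.+ n) (z ‖ z')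
  ‖-vanishesFrom {m} {n} {z} {z'} z≈0 z'≈0 w m+n≤∣w∣ = sumOver-zero (All.map term-vanishes (splits-++ w))
    where
    term-vanishes : ∀ {p} → proj₁ p ++ proj₂ p ≡ w → z (proj₁ p) * z' (proj₂ p) ≈ 0#
    term-vanishes {u , v} ≡.refl with ≤-+-split m n (≡.subst (m ℕ.+ n ≤_) (length-++ u) m+n≤∣w∣)
    ... | inj₁ m≤∣u∣ = trans (*-congʳ (z≈0 u m≤∣u∣)) (zeroˡ _)
    ... | inj₂ n≤∣v∣ = trans (*-congˡ (z'≈0 v n≤∣v∣)) (zeroʳ _)

  ‖-InTV : ∀ z z' → InTV z → InTV z' → InTV (z ‖ z')
  ‖-InTV z z' (m , z≈0) (n , z'≈0) = m ℕ.+ n , ‖-vanishesFrom z≈0 z'≈0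

  θL-‖-vanishes : ∀ {z z'} → Vanishes (θL z) → Vanishes (θL z') → Vanishes (θL (z ‖ z'))
  θL-‖-vanishes {z} {z'} θLz≈0 θLz'≈0 w = begin
    θL (z ‖ z') w                   ≈⟨ θL-‖ z z' w ⟩
    z [] * θL z' w + (θL z ‖ z') w  ≈⟨ +-cong (trans (*-congˡ (θLz'≈0 w)) (zeroʳ _)) (‖-zeroˡ z' θLz≈0 w) ⟩
    0# + 0#                         ≈⟨ +-identityʳ 0# ⟩
    0#                              ∎

  θR-‖-vanishes : ∀ {z z'} → Vanishes (θR z) → Vanishes (θR z') → Vanishes (θR (z ‖ z'))
  θR-‖-vanishes {z} {z'} θRz≈0 θRz'≈0 w = begin
    θR (z ‖ z') w                   ≈⟨ θR-‖ z z' w ⟩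
    (z ‖ θR z') w + θR z w * z' []  ≈⟨ +-cong (‖-zeroʳ z θRz'≈0 w) (trans (*-congʳ (θRz≈0 w)) (zeroˡ _)) ⟩
    0# + 0#                         ≈⟨ +-identityʳ 0# ⟩
    0#                              ∎

  ‖-InTX : ∀ z z' → InTX z → InTX z' → InTX (z ‖ z')
  ‖-InTX z z' (z∈TV , θz≈0) (z'∈TV , θz'≈0) = ‖-InTV z z' z∈TV z'∈TV , λ w →
    θL-‖-vanishes (proj₁ ∘ θz≈0) (proj₁ ∘ θz'≈0) w , θR-‖-vanishes (proj₂ ∘ θz≈0) (proj₂ ∘ θz'≈0) w

  degreeOne : (Fin q → Carrier) → Elem
  degreeOne v []          = 0#
  degreeOne v (a ∷ [])    = v a
  degreeOne v (a ∷ _ ∷ _) = 0#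

  degreeOne-InTW : ∀ v → InTW (degreeOne v)
  degreeOne-InTW v = (2 , vanishesFrom2) , θL≈θR
    where
    vanishesFrom2 : VanishesFrom 2 (degreeOne v)
    vanishesFrom2 (_ ∷ [])    (s≤s ())
    vanishesFrom2 (_ ∷ _ ∷ _) _ = refl
    θL≈θR : ∀ w → θL (degreeOne v) w ≈ θR (degreeOne v) w
    θL≈θR []          = refl
    θL≈θR (_ ∷ [])    = trans (sumFin-zero {q} (λ _ → zeroʳ t)) (sym (sumFin-zero {q} (λ _ → zeroʳ t)))
    θL≈θR (_ ∷ _ ∷ _) = trans (sumFin-zero {q} (λ _ → zeroʳ t)) (sym (sumFin-zero {q} (λ _ → zeroʳ t)))

  degreeOne-‖ : ∀ v v' a b → (degreeOne v ‖ degreeOne v') (a ∷ b ∷ []) ≈ v a * v' b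
  degreeOne-‖ v v' a b = begin
    0# * 0# + (v a * v' b + (0# * 0# + 0#))  ≈⟨ +-cong (zeroˡ 0#) (+-congˡ (trans (+-identityʳ _) (zeroˡ 0#))) ⟩
    0# + (v a * v' b + 0#)                   ≈⟨ trans (+-identityˡ _) (+-identityʳ _) ⟩
    v a * v' b                               ∎

  θL-degreeOne-‖ : ∀ v v' b → θL (degreeOne v ‖ degreeOne v') (b ∷ []) ≈ sumFin (λ a → t * v a) * v' b
  θL-degreeOne-‖ v v' b =
    trans (sumFin-cong {q} (λ a → trans (*-congˡ (degreeOne-‖ v v' a b)) (sym (*-assoc t _ _))))
          (sym (*-distribʳ-sumFin {q} (v' b) _))

  θR-degreeOne-‖ : ∀ v v' a → θR (degreeOne v ‖ degreeOne v') (a ∷ []) ≈ v a * sumFin (λ b → t * v' b)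
  θR-degreeOne-‖ v v' a =
    trans (sumFin-cong {q} (λ b → trans (*-congˡ (degreeOne-‖ v v' a b)) (x∙yz≈y∙xz t (v a) _)))
          (sym (*-distribˡ-sumFin {q} (v a) _))

module AtLeastTwoLetters {c ℓ} (R : CommutativeRing c ℓ) (k : ℕ) (t : CommutativeRing.Carrier R) where
  open CommutativeRing R hiding (zero)
  open Tensor R (suc (suc k)) t
  open TensorAlgebra R (suc (suc k)) t
  open import Relation.Binary.Reasoning.Setoid setoid

  e₀ e₁ : Fin (suc (suc k)) → Carrier
  e₀ zero    = 1#
  e₀ (suc _) = 0#
  e₁ zero          = 0#
  e₁ (suc zero)    = 1#
  e₁ (suc (suc _)) = 0#

  sumFin-t*e₀ : sumFin (λ a → t * e₀ a) ≈ t
  sumFin-t*e₀ = trans (+-cong (*-identityʳ t) (sumFin-zero {suc k} (λ _ → zeroʳ t))) (+-identityʳ t)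

  ‖-not-closed-InTW : ¬ t ≈ 0# → ¬ (∀ z z' → InTW z → InTW z' → InTW (z ‖ z'))
  ‖-not-closed-InTW t≉0 ‖-closed = t≉0 (begin
    t                                                   ≈⟨ trans (*-congʳ sumFin-t*e₀) (*-identityʳ t) ⟨
    sumFin (λ a → t * e₀ a) * 1#                        ≈⟨ θL-degreeOne-‖ e₀ e₁ (suc zero) ⟨
    θL (degreeOne e₀ ‖ degreeOne e₁) (suc zero ∷ [])  ≈⟨ proj₂ e₀e₁∈TW (suc zero ∷ []) ⟩
    θR (degreeOne e₀ ‖ degreeOne e₁) (suc zero ∷ [])  ≈⟨ θR-degreeOne-‖ e₀ e₁ (suc zero) ⟩
    0# * sumFin (λ b → t * e₁ b)                        ≈⟨ zeroˡ _ ⟩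
    0#                                                  ∎)
    where
    e₀e₁∈TW : InTW (degreeOne e₀ ‖ degreeOne e₁)
    e₀e₁∈TW = ‖-closed _ _ (degreeOne-InTW e₀) (degreeOne-InTW e₁)

mainTheorem8 : ∀ {c ℓ} (R : CommutativeRing c ℓ) → IsField R →
    (q : ℕ) → 2 ≤ q →
    (s t : CommutativeRing.Carrier R) →
    CommutativeRing._≈_ R (CommutativeRing._*_ R s s) (natToRing R q) →
    CommutativeRing._≈_ R (CommutativeRing._*_ R s t) (CommutativeRing.1# R) →
    let open Tensor R q t in
    ((∀ z z' → InTV z → InTV z' → InTV (z ‖ z'))
    × (∀ z z' → InTX z → InTX z' → InTX (z ‖ z')))
    × ¬ (∀ z z' → InTW z → InTW z' → InTW (z ‖ z'))
mainTheorem8 R (1≉0 , _) (suc (suc k)) (s≤s (s≤s z≤n)) s t _ s*t≈1 =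
  (‖-InTV , ‖-InTX) , ‖-not-closed-InTW t≉0
  where
  open CommutativeRing R
  open TensorAlgebra R (suc (suc k)) t
  open AtLeastTwoLetters R k t
  t≉0 : ¬ t ≈ 0#
  t≉0 t≈0 = 1≉0 (trans (sym s*t≈1) (trans (*-congˡ t≈0) (zeroʳ s)))
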